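{- Let $n>1$, $q=2^n$, $F$ a field of characteristic $2$, $a\in F$ nonzero, and let $\mathcal{Y}$ be the set of all elements $(r_1-r)/(r_1-r_0)$ where $r,r_0,r_1$ range over ordered triples of distinct roots of $x^{q+1}+ax+a$ in an algebraic closure $\overline F$. For $z\in\overline F$ with $z^q\neq z$, $c\in\mathbb{F}_q^\times$ and $j\in\mathbb{F}_{q,1}$ define $$e(z,c,j)=\frac{(cz^2+z+j/c)^{q+1}}{(z^q-z)^2}.$$ Then for every $y\in\mathcal{Y}$, $b\in\mathbb{F}_q^\times$, $c\in\mathbb{F}_q^\times$, $j\in\mathbb{F}_{q,1}$: $$e(y+b,c,j)=e(y,c,j+bc+(bc)^2),\qquad e(by,c,j)=e(y,bc,j),\qquad e(1/y,c,j)=e(y,j/c,j).$$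
   Context: $\mathbb{F}_{q,1}=\{d\in\mathbb{F}_q:\operatorname{Tr}_{\mathbb{F}_q/\mathbb{F}_2}(d)=1\}$. Every $y\in\mathcal{Y}$ satisfies $y\notin\mathbb{F}_q$, so $y+b$, $by$, $1/y$ also satisfy $z^q\ne z$ and all expressions are defined. -}

module Defs where

open import Level using (Level; _⊔_; suc)
open import Data.Nat using (ℕ; zero) renaming (suc to sucℕ; _^_ to _^ℕ_; _+_ to _+ℕ_; _≤_ to _≤ℕ_)
open import Data.List using (List; []; _∷_; _++_; [_]; length)
open import Data.List.Relation.Unary.Any using (Any)
open import Data.Product using (Σ; ∃; _×_; _,_)
open import Relation.Nullary using (¬_)
open import Algebra.Bundles using (CommutativeRing)
open import Algebra.Morphism.Structures using (IsRingHomomorphism)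

-- The inverse is a total function 'inv';
-- its value at 0 is unconstrained (and never used in the statement,
-- since every division there is by a nonzero element).
record Field (c ℓ : Level) : Set (suc (c ⊔ ℓ)) where
  field
    commutativeRing : CommutativeRing c ℓ
  open CommutativeRing commutativeRing public
  field
    inv     : Carrier → Carrier
    0≉1     : ¬ (0# ≈ 1#)
    inv-law : ∀ x → ¬ (x ≈ 0#) → (x * inv x) ≈ 1#

module FieldOps {c ℓ} (K : Field c ℓ) where
  open Field K

  infixr 8 _^_
  _^_ : Carrier → ℕ → Carrier
  x ^ zero = 1#
  x ^ sucℕ k = x * (x ^ k)

  infixl 7 _/_
  _/_ : Carrier → Carrier → Carrier
  x / y = x * inv y

  Char2 : Set ℓ
  Char2 = (1# + 1#) ≈ 0#

  -- polynomials with coefficients in K as coefficient lists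
  -- (constant coefficient first); evaluation by Horner's rule
  evalK : List Carrier → Carrier → Carrier
  evalK [] x = 0#
  evalK (a ∷ as) x = a + x * evalK as x

  -- K is algebraically closed: every monic polynomial of degree ≥ 1
  -- (coefficients as ++ [ 1# ], length as ≥ 1) has a root in K.
  AlgClosed : Set (c ⊔ ℓ)
  AlgClosed = ∀ (as : List Carrier) → 1 ≤ℕ length as →
              ∃ λ x → evalK (as ++ [ 1# ]) x ≈ 0#

  InFq : ℕ → Carrier → Set ℓ
  InFq n x = (x ^ (2 ^ℕ n)) ≈ x

  InFq× : ℕ → Carrier → Set ℓ
  InFq× n x = InFq n x × ¬ (x ≈ 0#)

  Tr : ℕ → Carrier → Carrier
  Tr zero x = 0#
  Tr (sucℕ i) x = Tr i x + x ^ (2 ^ℕ i)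

  InFq1 : ℕ → Carrier → Set ℓ
  InFq1 n x = InFq n x × (Tr n x ≈ 1#)

  e : ℕ → Carrier → Carrier → Carrier → Carrier
  e n z c j = ((c * z ^ 2 + z + j / c) ^ (2 ^ℕ n +ℕ 1)) / ((z ^ (2 ^ℕ n) - z) ^ 2)

module _ {c₁ ℓ₁ c₂ ℓ₂} (F : Field c₁ ℓ₁) (K : Field c₂ ℓ₂) where
  private
    module F = Field F
    module K = Field K

  evalι : (F.Carrier → K.Carrier) → List F.Carrier → K.Carrier → K.Carrier
  evalι ι [] x = K.0#
  evalι ι (a ∷ as) x = ι a K.+ (x K.* evalι ι as x)

  record IsAlgebraicClosure (ι : F.Carrier → K.Carrier) : Set (c₁ ⊔ ℓ₁ ⊔ c₂ ⊔ ℓ₂) where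
    field
      ι-hom     : IsRingHomomorphism F.rawRing K.rawRing ι
      closed    : FieldOps.AlgClosed K
      algebraic : ∀ (x : K.Carrier) →
                  ∃ λ (cs : List F.Carrier) →
                    Any (λ a → ¬ (a F.≈ F.0#)) cs × (evalι ι cs x K.≈ K.0#)

module YSet {c₂ ℓ₂} (K : Field c₂ ℓ₂) where
  open Field K
  open FieldOps K

  IsRoot : ℕ → Carrier → Carrier → Set ℓ₂
  IsRoot n a' r = (r ^ (2 ^ℕ n +ℕ 1) + a' * r + a') ≈ 0#

  InY : ℕ → Carrier → Carrier → Set (c₂ ⊔ ℓ₂)
  InY n a' y = Σ Carrier λ r → Σ Carrier λ r₀ → Σ Carrier λ r₁ →
    IsRoot n a' r × IsRoot n a' r₀ × IsRoot n a' r₁ ×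
    ¬ (r ≈ r₀) × ¬ (r ≈ r₁) × ¬ (r₀ ≈ r₁) ×
    (y ≈ ((r₁ - r) / (r₁ - r₀)))

-- All that is used about y ∈ 𝒴 is y ∉ 𝔽_q, which makes the denominators of e
-- nonzero; each identity then rescales numerator and denominator of e so that
-- the quotient is unchanged.  To see y ∉ 𝔽_q, note that r = (1 + y) r₁ + y r₀
-- in characteristic 2.  If y ∈ 𝔽_q, the Frobenius x ↦ x^q is 𝔽_q-linear, so
-- r^(q+1) + a r + a = (1 + y) y S with S = r₁^q r₀ + r₀^q r₁ + a (r₀ + r₁),
-- while r₀ r₁ S = a (r₀ + r₁)² because r₀ and r₁ are roots.  Since y ∉ {0, 1},
-- the first equation forces S = 0, hence a (r₀ + r₁)² = 0, contradicting r₀ ≠ r₁.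
module Submission where

open import Defs
open import Level using (Level)
open import Data.Nat using (ℕ; _≤_)
open import Data.Product using (_×_)
open import Relation.Nullary using (¬_)

open import Data.Nat using (zero; suc) renaming (_+_ to _+ℕ_; _^_ to _^ℕ_)
import Data.Nat.Properties as ℕ
open import Data.Product using (_,_)
open import Data.Maybe using (nothing)
open import Relation.Binary.PropositionalEquality as ≡ using (_≡_)
open import Algebra.Morphism.Structures using (IsRingHomomorphism)
import Algebra.Properties.CommutativeSemigroup as CommutativeSemigroupProperties
import Algebra.Properties.CommutativeSemiring.Exp as Exp
import Algebra.Solver.Ring.NaturalCoefficients as Solver
import Relation.Binary.Reasoning.Setoid as SetoidReasoning

module FieldProperties {c ℓ} (K : Field c ℓ) where
  open Field K
  open FieldOps K
  open SetoidReasoning setoid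
  open CommutativeSemigroupProperties *-commutativeSemigroup using (interchange)
  private module Std = Exp commutativeSemiring

  1≉0 : ¬ (1# ≈ 0#)
  1≉0 1≈0 = 0≉1 (sym 1≈0)

  inverseˡ : ∀ {x} → ¬ (x ≈ 0#) → inv x * x ≈ 1#
  inverseˡ {x} x≉0 = trans (*-comm (inv x) x) (inv-law x x≉0)

  *-≉0 : ∀ {x y} → ¬ (x ≈ 0#) → ¬ (y ≈ 0#) → ¬ (x * y ≈ 0#)
  *-≉0 {x} {y} x≉0 y≉0 xy≈0 = y≉0 (begin
    y                ≈⟨ *-identityˡ y ⟨
    1# * y           ≈⟨ *-congʳ (inverseˡ x≉0) ⟨
    (inv x * x) * y  ≈⟨ *-assoc (inv x) x y ⟩
    inv x * (x * y)  ≈⟨ *-congˡ xy≈0 ⟩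
    inv x * 0#       ≈⟨ zeroʳ (inv x) ⟩
    0#               ∎)

  ≉0-resp-≈ : ∀ {x y} → x ≈ y → ¬ (y ≈ 0#) → ¬ (x ≈ 0#)
  ≉0-resp-≈ x≈y y≉0 x≈0 = y≉0 (trans (sym x≈y) x≈0)

  inv-unique : ∀ {x y} → x * y ≈ 1# → inv x ≈ y
  inv-unique {x} {y} xy≈1 = begin
    inv x            ≈⟨ *-identityʳ (inv x) ⟨
    inv x * 1#       ≈⟨ *-congˡ xy≈1 ⟨
    inv x * (x * y)  ≈⟨ *-assoc (inv x) x y ⟨
    (inv x * x) * y  ≈⟨ *-congʳ (inverseˡ x≉0) ⟩
    1# * y           ≈⟨ *-identityˡ y ⟩
    y                ∎
    where
    x≉0 : ¬ (x ≈ 0#)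
    x≉0 x≈0 = 1≉0 (trans (sym xy≈1) (trans (*-congʳ x≈0) (zeroˡ y)))

  inv-cong : ∀ {x y} → x ≈ y → ¬ (y ≈ 0#) → inv x ≈ inv y
  inv-cong {x} {y} x≈y y≉0 = inv-unique (trans (*-congʳ x≈y) (inv-law y y≉0))

  inv-distrib-* : ∀ {x y} → ¬ (x ≈ 0#) → ¬ (y ≈ 0#) → inv (x * y) ≈ inv x * inv y
  inv-distrib-* {x} {y} x≉0 y≉0 = inv-unique (begin
    (x * y) * (inv x * inv y)  ≈⟨ interchange x y (inv x) (inv y) ⟩
    (x * inv x) * (y * inv y)  ≈⟨ *-cong (inv-law x x≉0) (inv-law y y≉0) ⟩
    1# * 1#                    ≈⟨ *-identityˡ 1# ⟩
    1#                         ∎)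

  /-cong : ∀ {x x′ d d′} → x ≈ x′ → d ≈ d′ → ¬ (d′ ≈ 0#) → x / d ≈ x′ / d′
  /-cong x≈x′ d≈d′ d′≉0 = *-cong x≈x′ (inv-cong d≈d′ d′≉0)

  /-cancelˡ : ∀ {s x d} → ¬ (s ≈ 0#) → ¬ (d ≈ 0#) → (s * x) / (s * d) ≈ x / d
  /-cancelˡ {s} {x} {d} s≉0 d≉0 = begin
    (s * x) * inv (s * d)      ≈⟨ *-congˡ (inv-distrib-* s≉0 d≉0) ⟩
    (s * x) * (inv s * inv d)  ≈⟨ interchange s x (inv s) (inv d) ⟩
    (s * inv s) * (x / d)      ≈⟨ *-congʳ (inv-law s s≉0) ⟩
    1# * (x / d)               ≈⟨ *-identityˡ (x / d) ⟩
    x / d                      ∎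

  x/[x/y]≈y : ∀ {x y} → ¬ (x ≈ 0#) → ¬ (y ≈ 0#) → x / (x / y) ≈ y
  x/[x/y]≈y {x} {y} x≉0 y≉0 = begin
    x * inv (x * inv y)  ≈⟨ *-congˡ (inv-unique x/y*y/x≈1) ⟩
    x * (inv x * y)      ≈⟨ *-assoc x (inv x) y ⟨
    (x * inv x) * y      ≈⟨ *-congʳ (inv-law x x≉0) ⟩
    1# * y               ≈⟨ *-identityˡ y ⟩
    y                    ∎
    where
    x/y*y/x≈1 : (x * inv y) * (inv x * y) ≈ 1#
    x/y*y/x≈1 = begin
      (x * inv y) * (inv x * y)  ≈⟨ interchange x (inv y) (inv x) y ⟩
      (x * inv x) * (inv y * y)  ≈⟨ *-cong (inv-law x x≉0) (inverseˡ y≉0) ⟩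
      1# * 1#                    ≈⟨ *-identityˡ 1# ⟩
      1#                         ∎

  zero-summands : ∀ {x y z u v} → u ≈ 0# → v ≈ 0# → x * u + y * v + z ≈ z
  zero-summands {x} {y} {z} {u} {v} u≈0 v≈0 = begin
    x * u + y * v + z    ≈⟨ +-congʳ (+-cong (*-congˡ u≈0) (*-congˡ v≈0)) ⟩
    x * 0# + y * 0# + z  ≈⟨ +-congʳ (+-cong (zeroʳ x) (zeroʳ y)) ⟩
    0# + 0# + z          ≈⟨ +-congʳ (+-identityʳ 0#) ⟩
    0# + z               ≈⟨ +-identityˡ z ⟩
    z                    ∎

  ^≡^ : ∀ x k → x ^ k ≡ x Std.^ k
  ^≡^ x zero    = ≡.refl
  ^≡^ x (suc k) = ≡.cong (x *_) (^≡^ x k)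

  ^-congˡ : ∀ k {x y} → x ≈ y → x ^ k ≈ y ^ k
  ^-congˡ k {x} {y} rewrite ^≡^ x k | ^≡^ y k = Std.^-congˡ k

  ^-homo-* : ∀ x i k → x ^ (i +ℕ k) ≈ x ^ i * x ^ k
  ^-homo-* x i k rewrite ^≡^ x (i +ℕ k) | ^≡^ x i | ^≡^ x k = Std.^-homo-* x i k

  ^-distrib-* : ∀ x y k → (x * y) ^ k ≈ x ^ k * y ^ k
  ^-distrib-* x y k rewrite ^≡^ (x * y) k | ^≡^ x k | ^≡^ y k = Std.^-distrib-* x y k

  x^[k+1]≈x^k*x : ∀ x k → x ^ (k +ℕ 1) ≈ x ^ k * x
  x^[k+1]≈x^k*x x k = trans (^-homo-* x k 1) (*-congˡ (*-identityʳ x))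

  x^2^[1+k]≈x^2^k*x^2^k : ∀ x k → x ^ (2 ^ℕ suc k) ≈ x ^ (2 ^ℕ k) * x ^ (2 ^ℕ k)
  x^2^[1+k]≈x^2^k*x^2^k x k = begin
    x ^ (2 ^ℕ k +ℕ (2 ^ℕ k +ℕ 0))  ≈⟨ ^-homo-* x (2 ^ℕ k) _ ⟩
    x ^ (2 ^ℕ k) * x ^ (2 ^ℕ k +ℕ 0)
      ≡⟨ ≡.cong (λ i → x ^ (2 ^ℕ k) * x ^ i) (ℕ.+-identityʳ (2 ^ℕ k)) ⟩
    x ^ (2 ^ℕ k) * x ^ (2 ^ℕ k)  ∎

  1^k≈1 : ∀ k → 1# ^ k ≈ 1#
  1^k≈1 zero    = refl
  1^k≈1 (suc k) = trans (*-identityˡ (1# ^ k)) (1^k≈1 k)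

  ^-≉0 : ∀ k {x} → ¬ (x ≈ 0#) → ¬ (x ^ k ≈ 0#)
  ^-≉0 zero    x≉0 = 1≉0
  ^-≉0 (suc k) x≉0 = *-≉0 x≉0 (^-≉0 k x≉0)

  x^2≈x*x : ∀ x → x ^ 2 ≈ x * x
  x^2≈x*x x = *-congˡ (*-identityʳ x)

  ratio-rescale : ∀ k {s t n n′ d d′} → ¬ (d′ ≈ 0#) → s ^ k ≈ t ^ 2 →
                  n′ ≈ s * n → d′ ≈ t * d → n′ ^ k / d′ ^ 2 ≈ n ^ k / d ^ 2
  ratio-rescale k {s} {t} {n} {n′} {d} {d′} d′≉0 sᵏ≈t² n′≈sn d′≈td = begin
    n′ ^ k / d′ ^ 2                    ≈⟨ /-cong n′ᵏ≈t²nᵏ d′²≈t²d² (*-≉0 t²≉0 d²≉0) ⟩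
    (t ^ 2 * n ^ k) / (t ^ 2 * d ^ 2)  ≈⟨ /-cancelˡ t²≉0 d²≉0 ⟩
    n ^ k / d ^ 2                      ∎
    where
    td≉0 : ¬ (t * d ≈ 0#)
    td≉0 td≈0 = d′≉0 (trans d′≈td td≈0)
    t²≉0 : ¬ (t ^ 2 ≈ 0#)
    t²≉0 = ^-≉0 2 λ t≈0 → td≉0 (trans (*-congʳ t≈0) (zeroˡ d))
    d²≉0 : ¬ (d ^ 2 ≈ 0#)
    d²≉0 = ^-≉0 2 λ d≈0 → td≉0 (trans (*-congˡ d≈0) (zeroʳ t))
    n′ᵏ≈t²nᵏ : n′ ^ k ≈ t ^ 2 * n ^ k
    n′ᵏ≈t²nᵏ = trans (^-congˡ k n′≈sn) (trans (^-distrib-* s n k) (*-congʳ sᵏ≈t²))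
    d′²≈t²d² : d′ ^ 2 ≈ t ^ 2 * d ^ 2
    d′²≈t²d² = trans (^-congˡ 2 d′≈td) (^-distrib-* t d 2)

module Characteristic2 {c ℓ} (K : Field c ℓ) (char2 : FieldOps.Char2 K) where
  open Field K
  open FieldOps K
  open FieldProperties K
  open SetoidReasoning setoid
  open Solver commutativeSemiring (λ _ _ → nothing)

  x+x≈0 : ∀ x → x + x ≈ 0#
  x+x≈0 x = begin
    x + x              ≈⟨ +-cong (*-identityˡ x) (*-identityˡ x) ⟨
    1# * x + 1# * x    ≈⟨ distribʳ x 1# 1# ⟨
    (1# + 1#) * x      ≈⟨ *-congʳ char2 ⟩
    0# * x             ≈⟨ zeroˡ x ⟩
    0#                 ∎

  -- Identities that hold only modulo 2 are proved by the semiring solver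
  -- after adding an explicit doubled term w + w to one side.
  cancel-double : ∀ {x y w} → x + (w + w) ≈ y → x ≈ y
  cancel-double {x} {y} {w} x+2w≈y = begin
    x            ≈⟨ +-identityʳ x ⟨
    x + 0#       ≈⟨ +-congˡ (x+x≈0 w) ⟨
    x + (w + w)  ≈⟨ x+2w≈y ⟩
    y            ∎

  x+y≈0⇒x≈y : ∀ {x y} → x + y ≈ 0# → x ≈ y
  x+y≈0⇒x≈y {x} {y} x+y≈0 = cancel-double (begin
    x + (y + y)  ≈⟨ +-assoc x y y ⟨
    x + y + y    ≈⟨ +-congʳ x+y≈0 ⟩
    0# + y       ≈⟨ +-identityˡ y ⟩
    y            ∎)

  x-y≈x+y : ∀ x y → x - y ≈ x + y
  x-y≈x+y x y = +-congˡ (x+y≈0⇒x≈y (-‿inverseˡ y))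

  x-y≈0⇒x≈y : ∀ {x y} → x - y ≈ 0# → x ≈ y
  x-y≈0⇒x≈y {x} {y} x-y≈0 = x+y≈0⇒x≈y (trans (sym (x-y≈x+y x y)) x-y≈0)

  [x+y]²≈x²+y² : ∀ x y → (x + y) * (x + y) ≈ x * x + y * y
  [x+y]²≈x²+y² x y = sym (cancel-double
    (solve 2 (λ x y → x :* x :+ y :* y :+ (x :* y :+ x :* y) := (x :+ y) :* (x :+ y)) refl x y))

  frobenius : ∀ k x y → (x + y) ^ (2 ^ℕ k) ≈ x ^ (2 ^ℕ k) + y ^ (2 ^ℕ k)
  frobenius zero    x y = distribʳ 1# x y
  frobenius (suc k) x y = begin
    (x + y) ^ (2 ^ℕ suc k)                   ≈⟨ x^2^[1+k]≈x^2^k*x^2^k (x + y) k ⟩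
    (x + y) ^ (2 ^ℕ k) * (x + y) ^ (2 ^ℕ k)  ≈⟨ *-cong (frobenius k x y) (frobenius k x y) ⟩
    (X + Y) * (X + Y)                        ≈⟨ [x+y]²≈x²+y² X Y ⟩
    X * X + Y * Y                            ≈⟨ +-cong (x^2^[1+k]≈x^2^k*x^2^k x k) (x^2^[1+k]≈x^2^k*x^2^k y k) ⟨
    x ^ (2 ^ℕ suc k) + y ^ (2 ^ℕ suc k)      ∎
    where
    X Y : Carrier
    X = x ^ (2 ^ℕ k)
    Y = y ^ (2 ^ℕ k)

  0^2^k≈0 : ∀ k → 0# ^ (2 ^ℕ k) ≈ 0#
  0^2^k≈0 k = begin
    0# ^ (2 ^ℕ k)                  ≈⟨ ^-congˡ (2 ^ℕ k) (+-identityʳ 0#) ⟨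
    (0# + 0#) ^ (2 ^ℕ k)           ≈⟨ frobenius k 0# 0# ⟩
    0# ^ (2 ^ℕ k) + 0# ^ (2 ^ℕ k)  ≈⟨ x+x≈0 (0# ^ (2 ^ℕ k)) ⟩
    0#                             ∎

  Tr-≈0 : ∀ k {x} → x ≈ 0# → Tr k x ≈ 0#
  Tr-≈0 zero    x≈0 = refl
  Tr-≈0 (suc k) x≈0 =
    trans (+-cong (Tr-≈0 k x≈0) (trans (^-congˡ (2 ^ℕ k) x≈0) (0^2^k≈0 k))) (+-identityʳ 0#)

  Tr≈1⇒≉0 : ∀ k {x} → Tr k x ≈ 1# → ¬ (x ≈ 0#)
  Tr≈1⇒≉0 k Tr≈1 x≈0 = 0≉1 (trans (sym (Tr-≈0 k x≈0)) Tr≈1)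

  cross-ratio⇒affine : ∀ {r r₀ r₁ y} → ¬ (r₀ ≈ r₁) → y ≈ (r₁ - r) / (r₁ - r₀) →
                       r ≈ (1# + y) * r₁ + y * r₀
  cross-ratio⇒affine {r} {r₀} {r₁} {y} r₀≉r₁ y≈ = begin
    r
      ≈⟨ cancel-double (solve 2 (λ r r₁ → r :+ (r₁ :+ r₁) := r₁ :+ (r₁ :+ r)) refl r r₁) ⟩
    r₁ + (r₁ + r)
      ≈⟨ +-congˡ y[r₁+r₀]≈r₁+r ⟨
    r₁ + y * (r₁ + r₀)
      ≈⟨ solve 3 (λ y r₀ r₁ → r₁ :+ y :* (r₁ :+ r₀) := (con 1 :+ y) :* r₁ :+ y :* r₀) refl y r₀ r₁ ⟩
    (1# + y) * r₁ + y * r₀ ∎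
    where
    r₁-r₀≉0 : ¬ (r₁ - r₀ ≈ 0#)
    r₁-r₀≉0 r₁-r₀≈0 = r₀≉r₁ (sym (x-y≈0⇒x≈y r₁-r₀≈0))
    y[r₁+r₀]≈r₁+r : y * (r₁ + r₀) ≈ r₁ + r
    y[r₁+r₀]≈r₁+r = begin
      y * (r₁ + r₀)                           ≈⟨ *-cong y≈ (sym (x-y≈x+y r₁ r₀)) ⟩
      (r₁ - r) / (r₁ - r₀) * (r₁ - r₀)        ≈⟨ *-assoc (r₁ - r) (inv (r₁ - r₀)) (r₁ - r₀) ⟩
      (r₁ - r) * (inv (r₁ - r₀) * (r₁ - r₀))  ≈⟨ *-congˡ (inverseˡ r₁-r₀≉0) ⟩
      (r₁ - r) * 1#                           ≈⟨ *-identityʳ (r₁ - r) ⟩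
      r₁ - r                                  ≈⟨ x-y≈x+y r₁ r ⟩
      r₁ + r                                  ∎

  module _ (n : ℕ) where
    private
      q m : ℕ
      q = 2 ^ℕ n
      m = q +ℕ 1

    ∉Fq⇒≉0 : ∀ {z} → ¬ InFq n z → ¬ (z ≈ 0#)
    ∉Fq⇒≉0 z∉Fq z≈0 = z∉Fq (trans (^-congˡ q z≈0) (trans (0^2^k≈0 n) (sym z≈0)))

    ∉Fq⇒z^q-z≉0 : ∀ {z} → ¬ InFq n z → ¬ (z ^ q - z ≈ 0#)
    ∉Fq⇒z^q-z≉0 z∉Fq z^q-z≈0 = z∉Fq (x-y≈0⇒x≈y z^q-z≈0)

    e-translate : ∀ {z} b c j → ¬ InFq n z → InFq n b → ¬ (c ≈ 0#) →
                  e n (z + b) c j ≈ e n z c (j + b * c + (b * c) ^ 2)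
    e-translate {z} b c j z∉Fq b∈Fq c≉0 =
      /-cong (^-congˡ m numerator) (^-congˡ 2 denominator) (^-≉0 2 (∉Fq⇒z^q-z≉0 z∉Fq))
      where
      c′ : Carrier
      c′ = inv c
      numerator : c * (z + b) ^ 2 + (z + b) + j * c′ ≈ c * z ^ 2 + z + (j + b * c + (b * c) ^ 2) * c′
      numerator = begin
        c * (z + b) ^ 2 + (z + b) + j * c′
          ≈⟨ cancel-double (solve 5 (λ c z b j c′ →
               c :* z :^ 2 :+ z :+ j :* c′ :+ b :* con 1 :+ b :* b :* c :* con 1 :+ (c :* z :* b :+ c :* z :* b)
               := c :* (z :+ b) :^ 2 :+ (z :+ b) :+ j :* c′) refl c z b j c′) ⟨
        c * z ^ 2 + z + j * c′ + b * 1# + b * b * c * 1#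
          ≈⟨ +-cong (+-congˡ (*-congˡ (inv-law c c≉0))) (*-congˡ (inv-law c c≉0)) ⟨
        c * z ^ 2 + z + j * c′ + b * (c * c′) + b * b * c * (c * c′)
          ≈⟨ solve 5 (λ c z b j c′ →
               c :* z :^ 2 :+ z :+ j :* c′ :+ b :* (c :* c′) :+ b :* b :* c :* (c :* c′)
               := c :* z :^ 2 :+ z :+ (j :+ b :* c :+ (b :* c) :^ 2) :* c′) refl c z b j c′ ⟩
        c * z ^ 2 + z + (j + b * c + (b * c) ^ 2) * c′ ∎
      denominator : (z + b) ^ q - (z + b) ≈ z ^ q - z
      denominator = begin
        (z + b) ^ q - (z + b)    ≈⟨ x-y≈x+y _ _ ⟩
        (z + b) ^ q + (z + b)    ≈⟨ +-congʳ (trans (frobenius n z b) (+-congˡ b∈Fq)) ⟩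
        (z ^ q + b) + (z + b)    ≈⟨ cancel-double (solve 3 (λ Z z b → Z :+ z :+ (b :+ b) := (Z :+ b) :+ (z :+ b))
                                                           refl (z ^ q) z b) ⟨
        z ^ q + z                ≈⟨ x-y≈x+y _ _ ⟨
        z ^ q - z                ∎

    e-scale : ∀ {z} b c j → ¬ InFq n z → InFq n b → ¬ (b ≈ 0#) → ¬ (c ≈ 0#) →
              e n (b * z) c j ≈ e n z (b * c) j
    e-scale {z} b c j z∉Fq b∈Fq b≉0 c≉0 =
      ratio-rescale m (≉0-resp-≈ denominator (*-≉0 b≉0 (∉Fq⇒z^q-z≉0 z∉Fq)))
        bᵐ≈b² numerator denominator
      where
      bᵐ≈b² : b ^ m ≈ b ^ 2
      bᵐ≈b² = trans (x^[k+1]≈x^k*x b q) (trans (*-congʳ b∈Fq) (sym (x^2≈x*x b)))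
      numerator : c * (b * z) ^ 2 + b * z + j / c ≈ b * (b * c * z ^ 2 + z + j / (b * c))
      numerator = begin
        c * (b * z) ^ 2 + b * z + j * inv c
          ≈⟨ +-congˡ (trans (*-congʳ (inv-law b b≉0)) (*-identityˡ _)) ⟨
        c * (b * z) ^ 2 + b * z + (b * inv b) * (j * inv c)
          ≈⟨ solve 6 (λ b c z j b′ c′ →
               c :* (b :* z) :^ 2 :+ b :* z :+ (b :* b′) :* (j :* c′)
               := b :* (b :* c :* z :^ 2 :+ z :+ j :* (b′ :* c′))) refl b c z j (inv b) (inv c) ⟩
        b * (b * c * z ^ 2 + z + j * (inv b * inv c))
          ≈⟨ *-congˡ (+-congˡ (*-congˡ (inv-distrib-* b≉0 c≉0))) ⟨
        b * (b * c * z ^ 2 + z + j / (b * c)) ∎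
      denominator : (b * z) ^ q - b * z ≈ b * (z ^ q - z)
      denominator = begin
        (b * z) ^ q - b * z  ≈⟨ +-congʳ (trans (^-distrib-* b z q) (*-congʳ b∈Fq)) ⟩
        b * z ^ q - b * z    ≈⟨ x-y≈x+y _ _ ⟩
        b * z ^ q + b * z    ≈⟨ distribˡ b (z ^ q) z ⟨
        b * (z ^ q + z)      ≈⟨ *-congˡ (x-y≈x+y _ _) ⟨
        b * (z ^ q - z)      ∎

    e-invert : ∀ {z} c j → ¬ InFq n z → ¬ (c ≈ 0#) → ¬ (j ≈ 0#) →
               e n (inv z) c j ≈ e n z (j / c) j
    e-invert {z} c j z∉Fq c≉0 j≉0 =
      sym (ratio-rescale m (∉Fq⇒z^q-z≉0 z∉Fq) [z²]ᵐ≈[zᵐ]² numerator denominator)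
      where
      w : Carrier
      w = inv z
      zw≈1 : z * w ≈ 1#
      zw≈1 = inv-law z (∉Fq⇒≉0 z∉Fq)
      [z²]ᵐ≈[zᵐ]² : (z ^ 2) ^ m ≈ (z ^ m) ^ 2
      [z²]ᵐ≈[zᵐ]² = begin
        (z ^ 2) ^ m      ≈⟨ ^-congˡ m (x^2≈x*x z) ⟩
        (z * z) ^ m      ≈⟨ ^-distrib-* z z m ⟩
        z ^ m * z ^ m    ≈⟨ x^2≈x*x (z ^ m) ⟨
        (z ^ m) ^ 2      ∎
      numerator : j / c * z ^ 2 + z + j / (j / c) ≈ z ^ 2 * (c * w ^ 2 + w + j / c)
      numerator = begin
        j * inv c * z ^ 2 + z + j / (j / c)
          ≈⟨ +-congˡ (x/[x/y]≈y j≉0 c≉0) ⟩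
        j * inv c * z ^ 2 + z + c
          ≈⟨ solve 4 (λ j c′ z c → j :* c′ :* z :^ 2 :+ z :+ c
                                  := c :* (con 1 :* con 1) :+ z :* con 1 :+ j :* c′ :* z :^ 2) refl j (inv c) z c ⟩
        c * (1# * 1#) + z * 1# + j * inv c * z ^ 2
          ≈⟨ +-congʳ (+-cong (*-congˡ (*-cong zw≈1 zw≈1)) (*-congˡ zw≈1)) ⟨
        c * ((z * w) * (z * w)) + z * (z * w) + j * inv c * z ^ 2
          ≈⟨ solve 5 (λ j c′ z c w → c :* ((z :* w) :* (z :* w)) :+ z :* (z :* w) :+ j :* c′ :* z :^ 2
                                    := z :^ 2 :* (c :* w :^ 2 :+ w :+ j :* c′)) refl j (inv c) z c w ⟩
        z ^ 2 * (c * w ^ 2 + w + j * inv c) ∎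
      z^q*w^q≈1 : z ^ q * w ^ q ≈ 1#
      z^q*w^q≈1 = trans (sym (^-distrib-* z w q)) (trans (^-congˡ q zw≈1) (1^k≈1 q))
      denominator : z ^ q - z ≈ z ^ m * (w ^ q - w)
      denominator = begin
        z ^ q - z
          ≈⟨ x-y≈x+y (z ^ q) z ⟩
        z ^ q + z
          ≈⟨ solve 2 (λ Z z → Z :+ z := z :* con 1 :+ Z :* con 1) refl (z ^ q) z ⟩
        z * 1# + z ^ q * 1#
          ≈⟨ +-cong (*-congˡ z^q*w^q≈1) (*-congˡ zw≈1) ⟨
        z * (z ^ q * w ^ q) + z ^ q * (z * w)
          ≈⟨ solve 4 (λ z Z w W → z :* (Z :* W) :+ Z :* (z :* w) := (Z :* z) :* (W :+ w))
                     refl z (z ^ q) w (w ^ q) ⟩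
        (z ^ q * z) * (w ^ q + w)
          ≈⟨ *-cong (x^[k+1]≈x^k*x z q) (x-y≈x+y (w ^ q) w) ⟨
        z ^ m * (w ^ q - w) ∎

    module _ (a : Carrier) where
      -- x^(q+1) + a x + a with the Frobenius factor split off.
      f : Carrier → Carrier
      f x = x ^ q * x + a * x + a

      cross-term : Carrier → Carrier → Carrier
      cross-term r₀ r₁ = r₁ ^ q * r₀ + r₀ ^ q * r₁ + a * r₀ + a * r₁

      IsRoot⇒f≈0 : ∀ {x} → YSet.IsRoot K n a x → f x ≈ 0#
      IsRoot⇒f≈0 {x} root = trans (+-congʳ (+-congʳ (sym (x^[k+1]≈x^k*x x q)))) root

      f-affine : ∀ {r r₀ r₁ y} → InFq n y → r ≈ (1# + y) * r₁ + y * r₀ →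
                 f r₀ ≈ 0# → f r₁ ≈ 0# → f r ≈ (1# + y) * y * cross-term r₀ r₁
      f-affine {r} {r₀} {r₁} {y} y∈Fq r≈ f[r₀]≈0 f[r₁]≈0 = begin
        r ^ q * r + a * r + a
          ≈⟨ +-cong (+-cong (*-cong r^q≈ r≈) (*-congˡ r≈)) refl ⟩
        ((1# + y) * Q₁ + y * Q₀) * ((1# + y) * r₁ + y * r₀) + a * ((1# + y) * r₁ + y * r₀) + a
          ≈⟨ cancel-double (solve 6 (λ a y r₀ r₁ Q₀ Q₁ →
               ((con 1 :+ y) :* Q₁ :+ y :* Q₀) :* ((con 1 :+ y) :* r₁ :+ y :* r₀)
                 :+ a :* ((con 1 :+ y) :* r₁ :+ y :* r₀) :+ a
                 :+ (w a y r₀ r₁ :+ w a y r₀ r₁)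
               := (con 1 :+ y) :* (con 1 :+ y) :* (Q₁ :* r₁ :+ a :* r₁ :+ a)
                 :+ y :* y :* (Q₀ :* r₀ :+ a :* r₀ :+ a)
                 :+ (con 1 :+ y) :* y :* (Q₁ :* r₀ :+ Q₀ :* r₁ :+ a :* r₀ :+ a :* r₁))
               refl a y r₀ r₁ Q₀ Q₁) ⟩
        (1# + y) * (1# + y) * f r₁ + y * y * f r₀ + (1# + y) * y * cross-term r₀ r₁
          ≈⟨ zero-summands f[r₁]≈0 f[r₀]≈0 ⟩
        (1# + y) * y * cross-term r₀ r₁ ∎
        where
        Q₀ Q₁ : Carrier
        Q₀ = r₀ ^ q
        Q₁ = r₁ ^ q
        w : ∀ {k} → Polynomial k → Polynomial k → Polynomial k → Polynomial k → Polynomial k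
        w a y r₀ r₁ = a :* r₁ :* (con 1 :+ y) :* y :+ a :* r₀ :* y :* y :+ a :* (y :+ y :* y)
        1+y∈Fq : InFq n (1# + y)
        1+y∈Fq = trans (frobenius n 1# y) (+-cong (1^k≈1 q) y∈Fq)
        r^q≈ : r ^ q ≈ (1# + y) * Q₁ + y * Q₀
        r^q≈ = begin
          r ^ q                                ≈⟨ ^-congˡ q r≈ ⟩
          ((1# + y) * r₁ + y * r₀) ^ q         ≈⟨ frobenius n _ _ ⟩
          ((1# + y) * r₁) ^ q + (y * r₀) ^ q   ≈⟨ +-cong (^-distrib-* _ r₁ q) (^-distrib-* y r₀ q) ⟩
          (1# + y) ^ q * Q₁ + y ^ q * Q₀       ≈⟨ +-cong (*-congʳ 1+y∈Fq) (*-congʳ y∈Fq) ⟩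
          (1# + y) * Q₁ + y * Q₀               ∎

      cross-term-roots : ∀ {r₀ r₁} → f r₀ ≈ 0# → f r₁ ≈ 0# →
                         r₀ * r₁ * cross-term r₀ r₁ ≈ a * ((r₀ + r₁) * (r₀ + r₁))
      cross-term-roots {r₀} {r₁} f[r₀]≈0 f[r₁]≈0 = begin
        r₀ * r₁ * cross-term r₀ r₁
          ≈⟨ cancel-double (solve 5 (λ a r₀ r₁ Q₀ Q₁ →
               r₀ :* r₁ :* (Q₁ :* r₀ :+ Q₀ :* r₁ :+ a :* r₀ :+ a :* r₁)
                 :+ (w a r₀ r₁ :+ w a r₀ r₁)
               := r₀ :* r₀ :* (Q₁ :* r₁ :+ a :* r₁ :+ a) :+ r₁ :* r₁ :* (Q₀ :* r₀ :+ a :* r₀ :+ a)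
                 :+ a :* ((r₀ :+ r₁) :* (r₀ :+ r₁)))
               refl a r₀ r₁ (r₀ ^ q) (r₁ ^ q)) ⟩
        r₀ * r₀ * f r₁ + r₁ * r₁ * f r₀ + a * ((r₀ + r₁) * (r₀ + r₁))
          ≈⟨ zero-summands f[r₁]≈0 f[r₀]≈0 ⟩
        a * ((r₀ + r₁) * (r₀ + r₁)) ∎
        where
        w : ∀ {k} → Polynomial k → Polynomial k → Polynomial k → Polynomial k
        w a r₀ r₁ = a :* (r₀ :* r₀ :+ r₀ :* r₁ :+ r₁ :* r₁)

      InY⇒∉Fq : ¬ (a ≈ 0#) → ∀ {y} → YSet.InY K n a y → ¬ InFq n y
      InY⇒∉Fq a≉0 {y} (r , r₀ , r₁ , root , root₀ , root₁ , r≉r₀ , r≉r₁ , r₀≉r₁ , y≈) y∈Fq =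
        *-≉0 (*-≉0 (*-≉0 u≉0 y≉0) a≉0) (*-≉0 s≉0 s≉0) uyas²≈0
        where
        u s : Carrier
        u = 1# + y
        s = r₀ + r₁
        r≈ : r ≈ u * r₁ + y * r₀
        r≈ = cross-ratio⇒affine r₀≉r₁ y≈
        f[r₀]≈0 : f r₀ ≈ 0#
        f[r₀]≈0 = IsRoot⇒f≈0 root₀
        f[r₁]≈0 : f r₁ ≈ 0#
        f[r₁]≈0 = IsRoot⇒f≈0 root₁
        uyS≈0 : u * y * cross-term r₀ r₁ ≈ 0#
        uyS≈0 = trans (sym (f-affine y∈Fq r≈ f[r₀]≈0 f[r₁]≈0)) (IsRoot⇒f≈0 root)
        uyas²≈0 : u * y * a * (s * s) ≈ 0#
        uyas²≈0 = begin
          u * y * a * (s * s)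
            ≈⟨ *-assoc (u * y) a (s * s) ⟩
          u * y * (a * (s * s))
            ≈⟨ *-congˡ (cross-term-roots f[r₀]≈0 f[r₁]≈0) ⟨
          u * y * (r₀ * r₁ * cross-term r₀ r₁)
            ≈⟨ solve 5 (λ u y r₀ r₁ S → u :* y :* (r₀ :* r₁ :* S) := r₀ :* r₁ :* (u :* y :* S))
                       refl u y r₀ r₁ (cross-term r₀ r₁) ⟩
          r₀ * r₁ * (u * y * cross-term r₀ r₁)
            ≈⟨ *-congˡ uyS≈0 ⟩
          r₀ * r₁ * 0#
            ≈⟨ zeroʳ (r₀ * r₁) ⟩
          0# ∎
        u≉0 : ¬ (u ≈ 0#)
        u≉0 u≈0 = r≉r₀ (begin
          r                  ≈⟨ r≈ ⟩
          u * r₁ + y * r₀    ≈⟨ +-cong (*-congʳ u≈0) (*-congʳ (sym (x+y≈0⇒x≈y u≈0))) ⟩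
          0# * r₁ + 1# * r₀  ≈⟨ trans (+-cong (zeroˡ r₁) (*-identityˡ r₀)) (+-identityˡ r₀) ⟩
          r₀                 ∎)
        y≉0 : ¬ (y ≈ 0#)
        y≉0 y≈0 = r≉r₁ (begin
          r                         ≈⟨ r≈ ⟩
          (1# + y) * r₁ + y * r₀    ≈⟨ +-cong (*-congʳ (+-congˡ y≈0)) (*-congʳ y≈0) ⟩
          (1# + 0#) * r₁ + 0# * r₀  ≈⟨ +-cong (*-congʳ (+-identityʳ 1#)) (zeroˡ r₀) ⟩
          1# * r₁ + 0#              ≈⟨ trans (+-identityʳ _) (*-identityˡ r₁) ⟩
          r₁                        ∎)
        s≉0 : ¬ (s ≈ 0#)
        s≉0 s≈0 = r₀≉r₁ (x+y≈0⇒x≈y s≈0)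

module RingHomomorphism {c₁ ℓ₁ c₂ ℓ₂} (F : Field c₁ ℓ₁) (K : Field c₂ ℓ₂)
  {ι : Field.Carrier F → Field.Carrier K}
  (hom : IsRingHomomorphism (Field.rawRing F) (Field.rawRing K) ι) where
  private
    module F = Field F
    module K = Field K
  open IsRingHomomorphism hom
  open SetoidReasoning K.setoid

  Char2-preserved : FieldOps.Char2 F → FieldOps.Char2 K
  Char2-preserved char2 = begin
    K.1# K.+ K.1#      ≈⟨ K.+-cong 1#-homo 1#-homo ⟨
    ι F.1# K.+ ι F.1#  ≈⟨ +-homo F.1# F.1# ⟨
    ι (F.1# F.+ F.1#)  ≈⟨ ⟦⟧-cong char2 ⟩
    ι F.0#             ≈⟨ 0#-homo ⟩
    K.0#               ∎

  ≉0-preserved : ∀ {x} → ¬ (x F.≈ F.0#) → ¬ (ι x K.≈ K.0#)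
  ≉0-preserved {x} x≉0 ιx≈0 = K.0≉1 (begin
    K.0#                  ≈⟨ K.zeroˡ (ι (F.inv x)) ⟨
    K.0# K.* ι (F.inv x)  ≈⟨ K.*-congʳ ιx≈0 ⟨
    ι x K.* ι (F.inv x)   ≈⟨ *-homo x (F.inv x) ⟨
    ι (x F.* F.inv x)     ≈⟨ ⟦⟧-cong (F.inv-law x x≉0) ⟩
    ι F.1#                ≈⟨ 1#-homo ⟩
    K.1#                  ∎)

lemma6p1 : ∀ {c₁ ℓ₁ c₂ ℓ₂ : Level}
    (n : ℕ) → 2 ≤ n →
    (F : Field c₁ ℓ₁) → FieldOps.Char2 F →
    (a : Field.Carrier F) → ¬ (Field._≈_ F a (Field.0# F)) →
    (K : Field c₂ ℓ₂) (ι : Field.Carrier F → Field.Carrier K) → IsAlgebraicClosure F K ι →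
    let open Field K
        open FieldOps K
    in ∀ (y : Carrier) → YSet.InY K n (ι a) y →
       ∀ (b c j : Carrier) → InFq× n b → InFq× n c → InFq1 n j →
         (e n (y + b) c j ≈ e n y c (j + b * c + (b * c) ^ 2))
       × (e n (b * y) c j ≈ e n y (b * c) j)
       × (e n (inv y) c j ≈ e n y (j / c) j)
lemma6p1 n _ F char2 a a≉0 K ι closure y y∈𝒴 b c j (b∈Fq , b≉0) (_ , c≉0) (_ , Tr[j]≈1) =
    e-translate n b c j y∉Fq b∈Fq c≉0
  , e-scale n b c j y∉Fq b∈Fq b≉0 c≉0
  , e-invert n c j y∉Fq c≉0 (Tr≈1⇒≉0 n Tr[j]≈1)
  where
  open RingHomomorphism F K (IsAlgebraicClosure.ι-hom closure)
  open Characteristic2 K (Char2-preserved char2)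
  y∉Fq : ¬ FieldOps.InFq K n y
  y∉Fq = InY⇒∉Fq n (ι a) (≉0-preserved a≉0) y∈𝒴
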